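{- Let $N\ge1$ and let $\mathfrak{F}(x_1,\dots,x_N,y_1,\dots,y_N)$ be a polynomial with rational coefficients that is symmetric under the simultaneous interchange $x_r\leftrightarrow y_r$ for all $r=1,\dots,N$, i.e. $\mathfrak{F}(\mathbf{x},\mathbf{y})=\mathfrak{F}(\mathbf{y},\mathbf{x})$. Let $g_1(t),\dots,g_N(t)$ be arbitrary polynomials in $t$ with rational coefficients, let $p$ be a positive integer, and define $G(t)=\mathfrak{F}(\mathbf{x},\mathbf{y})$ evaluated at $x_r=g_r(t)$, $y_r=g_r(t^p)$ for $r=1,\dots,N$. Then $G(t)\equiv G(t^p)$ modulo the ideal of $\mathbb{Q}[t]$ generated by $t^{p^2-1}-1$. -}

module Defs where

open import Data.Nat using (ℕ; zero; suc) renaming (_∸_ to _∸ℕ_; _*_ to _*ℕ_)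
import Data.Nat as ℕ
open import Data.Fin using (Fin; zero; suc)
open import Data.Rational using (ℚ; 0ℚ; 1ℚ; _+_; _*_; -_)
open import Data.List using (List; []; _∷_; map)
open import Data.Vec using (Vec; lookup)
open import Data.Vec.Properties using (≡-dec)
open import Data.Product using (_×_; _,_; Σ)
open import Relation.Nullary using (yes; no; _×-dec_)
open import Relation.Binary.PropositionalEquality using (_≡_)

-- Univariate polynomials in ℚ[t]: coefficient lists, constant term first.
-- Two lists denote the same polynomial iff all their coefficients agree
-- (trailing zeros are irrelevant).

Poly : Set
Poly = List ℚ

coeff : Poly → ℕ → ℚ
coeff []      _       = 0ℚ
coeff (a ∷ _) zero    = a
coeff (_ ∷ p) (suc i) = coeff p i

_≈P_ : Poly → Poly → Set
P ≈P Q = ∀ i → coeff P i ≡ coeff Q i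

_⊕_ : Poly → Poly → Poly
[]      ⊕ q       = q
(a ∷ p) ⊕ []      = a ∷ p
(a ∷ p) ⊕ (b ∷ q) = (a + b) ∷ (p ⊕ q)

scale : ℚ → Poly → Poly
scale c = map (c *_)

⊖_ : Poly → Poly
⊖ p = scale (- 1ℚ) p

_⊛_ : Poly → Poly → Poly
[]      ⊛ q = []
(a ∷ p) ⊛ q = scale a q ⊕ (0ℚ ∷ (p ⊛ q))

constP : ℚ → Poly
constP c = c ∷ []

oneP : Poly
oneP = constP 1ℚ

tP : Poly
tP = 0ℚ ∷ 1ℚ ∷ []

_^P_ : Poly → ℕ → Poly
p ^P zero  = oneP
p ^P suc n = p ⊛ (p ^P n)

compose : Poly → Poly → Poly
compose []      Q = []
compose (a ∷ p) Q = constP a ⊕ (Q ⊛ compose p Q)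

atPow : Poly → ℕ → Poly
atPow P p = compose P (tP ^P p)

_≡_[mod_] : Poly → Poly → Poly → Set
P ≡ Q [mod M ] = Σ Poly λ R → (P ⊕ (⊖ Q)) ≈P (M ⊛ R)

-- Polynomials in ℚ[x₁..x_N, y₁..y_N]: finite lists of terms
-- c · x^a · y^b  with exponent vectors a b : Vec ℕ N.
-- The coefficient of a monomial is the sum of the coefficients of all
-- terms carrying it, so two term lists denote the same polynomial iff
-- all monomial coefficients agree.

Term : ℕ → Set
Term N = ℚ × Vec ℕ N × Vec ℕ N

MPoly : ℕ → Set
MPoly N = List (Term N)

mcoeff : ∀ {N} → MPoly N → Vec ℕ N → Vec ℕ N → ℚ
mcoeff []                  a b = 0ℚ
mcoeff ((c , a′ , b′) ∷ F) a b with ≡-dec ℕ._≟_ a′ a ×-dec ≡-dec ℕ._≟_ b′ b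
... | yes _ = c + mcoeff F a b
... | no  _ = mcoeff F a b

SwapSymmetric : ∀ {N} → MPoly N → Set
SwapSymmetric F = ∀ a b → mcoeff F a b ≡ mcoeff F b a

prodP : ∀ n → (Fin n → Poly) → Poly
prodP zero    f = oneP
prodP (suc n) f = f zero ⊛ prodP n (λ r → f (suc r))

evalM : ∀ {N} → MPoly N → (Fin N → Poly) → (Fin N → Poly) → Poly
evalM {N} []                u v = []
evalM {N} ((c , a , b) ∷ F) u v =
  (scale c (prodP N (λ r → (u r ^P lookup a r) ⊛ (v r ^P lookup b r))))
    ⊕ evalM F u v

G : ∀ {N} → MPoly N → (Fin N → Poly) → ℕ → Poly
G F g p = evalM F g (λ r → atPow (g r) p)

modulus : ℕ → Poly
modulus p = (tP ^P ((p *ℕ p) ∸ℕ 1)) ⊕ (⊖ oneP)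

-- Idea: substituting t^p is a ring endomorphism of ℚ[t] and commutes with
-- evaluating 𝔉, so G(t^p) = 𝔉(g(t^p), g(t^(p²))).  As t^(p²) − t =
-- (t^(p²−1) − 1)·t, we have t^(p²) ≡ t, and congruence is preserved by all
-- polynomial expressions; hence G(t^p) ≡ 𝔉(g(t^p), g(t)) = 𝔉(g(t), g(t^p)).
module Submission where

open import Defs
open import Data.Nat using (ℕ; zero; suc; _≥_; _≤_; z≤n; s≤s) renaming (_+_ to _+ℕ_; _*_ to _*ℕ_)
import Data.Nat as ℕ
import Data.Nat.Properties as ℕ
open import Data.Rational using (ℚ; 0ℚ; 1ℚ; _+_; _*_; -_)
import Data.Rational.Properties as ℚ
open import Data.List using ([]; _∷_; length)
open import Data.Fin using (Fin; zero; suc)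
open import Data.Vec using (Vec; lookup)
open import Data.Vec.Properties using (≡-dec)
open import Data.Maybe using (Maybe; just; nothing)
open import Data.Product using (_,_; _×_)
open import Data.Empty using (⊥-elim)
open import Relation.Nullary using (yes; no; ¬_; _×-dec_)
open import Relation.Binary.PropositionalEquality using (_≡_; refl; sym; trans; cong; cong₂; module ≡-Reasoning)
open import Relation.Binary.Bundles using (Setoid)
open import Relation.Binary.Structures using (IsEquivalence; IsPreorder)
import Relation.Binary.Reasoning.Setoid as SetoidReasoning
import Relation.Binary.Reasoning.Base.Double as PreorderReasoning
open import Algebra.Bundles using (CommutativeRing; CommutativeSemigroup)
open import Algebra.Structures using (IsSemigroup)
open import Level using (0ℓ)
open import Tactic.RingSolver using (solve-∀)
open import Tactic.RingSolver.Core.AlmostCommutativeRing using (AlmostCommutativeRing; fromCommutativeRing)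

-- Equality of polynomials as a record wrapping Defs' coefficientwise
-- equality _≈P_, so that the two polynomials can be inferred from a proof.
infix 4 _≈_
record _≈_ (p q : Poly) : Set where
  constructor coeffwise
  field at : p ≈P q
open _≈_ public

≈-refl : ∀ {p} → p ≈ p
≈-refl = coeffwise λ _ → refl

≈-reflexive : ∀ {p q} → p ≡ q → p ≈ q
≈-reflexive refl = ≈-refl

≈-sym : ∀ {p q} → p ≈ q → q ≈ p
≈-sym h = coeffwise λ i → sym (at h i)

≈-trans : ∀ {p q r} → p ≈ q → q ≈ r → p ≈ r
≈-trans h k = coeffwise λ i → trans (at h i) (at k i)

≈-isEquivalence : IsEquivalence _≈_
≈-isEquivalence = record { refl = ≈-refl ; sym = ≈-sym ; trans = ≈-trans }

≈-setoid : Setoid 0ℓ 0ℓ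
≈-setoid = record { isEquivalence = ≈-isEquivalence }

module Coefficientwise where
  open ≡-Reasoning

  coeff-⊕ : ∀ p q i → coeff (p ⊕ q) i ≡ coeff p i + coeff q i
  coeff-⊕ []      q       i       = sym (ℚ.+-identityˡ (coeff q i))
  coeff-⊕ (a ∷ p) []      i       = sym (ℚ.+-identityʳ (coeff (a ∷ p) i))
  coeff-⊕ (a ∷ p) (b ∷ q) zero    = refl
  coeff-⊕ (a ∷ p) (b ∷ q) (suc i) = coeff-⊕ p q i

  coeff-scale : ∀ c p i → coeff (scale c p) i ≡ c * coeff p i
  coeff-scale c []      i       = sym (ℚ.*-zeroʳ c)
  coeff-scale c (a ∷ p) zero    = refl
  coeff-scale c (a ∷ p) (suc i) = coeff-scale c p i

  cons-cong : ∀ {a b p q} → a ≡ b → p ≈ q → (a ∷ p) ≈ (b ∷ q)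
  cons-cong a≡b p≈q = coeffwise λ { zero → a≡b ; (suc i) → at p≈q i }

  ⊕-cong : ∀ {p p′ q q′} → p ≈ p′ → q ≈ q′ → (p ⊕ q) ≈ (p′ ⊕ q′)
  ⊕-cong {p} {p′} {q} {q′} h k = coeffwise λ i → begin
    coeff (p ⊕ q) i         ≡⟨ coeff-⊕ p q i ⟩
    coeff p i + coeff q i   ≡⟨ cong₂ _+_ (at h i) (at k i) ⟩
    coeff p′ i + coeff q′ i ≡⟨ coeff-⊕ p′ q′ i ⟨
    coeff (p′ ⊕ q′) i       ∎

  ⊕-comm : ∀ p q → (p ⊕ q) ≈ (q ⊕ p)
  ⊕-comm p q = coeffwise λ i → begin
    coeff (p ⊕ q) i       ≡⟨ coeff-⊕ p q i ⟩
    coeff p i + coeff q i ≡⟨ ℚ.+-comm (coeff p i) (coeff q i) ⟩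
    coeff q i + coeff p i ≡⟨ coeff-⊕ q p i ⟨
    coeff (q ⊕ p) i       ∎

  ⊕-assoc : ∀ p q r → ((p ⊕ q) ⊕ r) ≈ (p ⊕ (q ⊕ r))
  ⊕-assoc p q r = coeffwise λ i → begin
    coeff ((p ⊕ q) ⊕ r) i                   ≡⟨ coeff-⊕ (p ⊕ q) r i ⟩
    coeff (p ⊕ q) i + coeff r i             ≡⟨ cong (_+ coeff r i) (coeff-⊕ p q i) ⟩
    (coeff p i + coeff q i) + coeff r i     ≡⟨ ℚ.+-assoc (coeff p i) (coeff q i) (coeff r i) ⟩
    coeff p i + (coeff q i + coeff r i)     ≡⟨ cong (coeff p i +_) (coeff-⊕ q r i) ⟨
    coeff p i + coeff (q ⊕ r) i             ≡⟨ coeff-⊕ p (q ⊕ r) i ⟨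
    coeff (p ⊕ (q ⊕ r)) i                   ∎

  ⊕-identityʳ : ∀ p → (p ⊕ []) ≈ p
  ⊕-identityʳ []      = ≈-refl
  ⊕-identityʳ (a ∷ p) = ≈-refl

  ⊖-inverseʳ : ∀ p → (p ⊕ (⊖ p)) ≈ []
  ⊖-inverseʳ p = coeffwise λ i → begin
    coeff (p ⊕ (⊖ p)) i               ≡⟨ coeff-⊕ p (⊖ p) i ⟩
    coeff p i + coeff (⊖ p) i         ≡⟨ cong (coeff p i +_) (coeff-scale (- 1ℚ) p i) ⟩
    coeff p i + (- 1ℚ) * coeff p i    ≡⟨ cong (coeff p i +_) (ℚ.neg-distribˡ-* 1ℚ (coeff p i)) ⟨
    coeff p i + - (1ℚ * coeff p i)    ≡⟨ cong (λ x → coeff p i + - x) (ℚ.*-identityˡ (coeff p i)) ⟩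
    coeff p i + - coeff p i           ≡⟨ ℚ.+-inverseʳ (coeff p i) ⟩
    0ℚ                                ∎

  scale-cong : ∀ c {p q} → p ≈ q → scale c p ≈ scale c q
  scale-cong c {p} {q} h = coeffwise λ i → begin
    coeff (scale c p) i ≡⟨ coeff-scale c p i ⟩
    c * coeff p i       ≡⟨ cong (c *_) (at h i) ⟩
    c * coeff q i       ≡⟨ coeff-scale c q i ⟨
    coeff (scale c q) i ∎

  scale-distrib-⊕ : ∀ c p q → scale c (p ⊕ q) ≈ (scale c p ⊕ scale c q)
  scale-distrib-⊕ c p q = coeffwise λ i → begin
    coeff (scale c (p ⊕ q)) i                 ≡⟨ coeff-scale c (p ⊕ q) i ⟩
    c * coeff (p ⊕ q) i                       ≡⟨ cong (c *_) (coeff-⊕ p q i) ⟩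
    c * (coeff p i + coeff q i)               ≡⟨ ℚ.*-distribˡ-+ c (coeff p i) (coeff q i) ⟩
    c * coeff p i + c * coeff q i             ≡⟨ cong₂ _+_ (coeff-scale c p i) (coeff-scale c q i) ⟨
    coeff (scale c p) i + coeff (scale c q) i ≡⟨ coeff-⊕ (scale c p) (scale c q) i ⟨
    coeff (scale c p ⊕ scale c q) i           ∎

  scale-distrib-+ : ∀ a b p → scale (a + b) p ≈ (scale a p ⊕ scale b p)
  scale-distrib-+ a b p = coeffwise λ i → begin
    coeff (scale (a + b) p) i                 ≡⟨ coeff-scale (a + b) p i ⟩
    (a + b) * coeff p i                       ≡⟨ ℚ.*-distribʳ-+ (coeff p i) a b ⟩
    a * coeff p i + b * coeff p i             ≡⟨ cong₂ _+_ (coeff-scale a p i) (coeff-scale b p i) ⟨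
    coeff (scale a p) i + coeff (scale b p) i ≡⟨ coeff-⊕ (scale a p) (scale b p) i ⟨
    coeff (scale a p ⊕ scale b p) i           ∎

  scale-assoc : ∀ a b p → scale (a * b) p ≈ scale a (scale b p)
  scale-assoc a b p = coeffwise λ i → begin
    coeff (scale (a * b) p) i     ≡⟨ coeff-scale (a * b) p i ⟩
    (a * b) * coeff p i           ≡⟨ ℚ.*-assoc a b (coeff p i) ⟩
    a * (b * coeff p i)           ≡⟨ cong (a *_) (coeff-scale b p i) ⟨
    a * coeff (scale b p) i       ≡⟨ coeff-scale a (scale b p) i ⟨
    coeff (scale a (scale b p)) i ∎

  scale-zero : ∀ p → scale 0ℚ p ≈ []
  scale-zero p = coeffwise λ i → trans (coeff-scale 0ℚ p i) (ℚ.*-zeroˡ (coeff p i))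

  scale-one : ∀ p → scale 1ℚ p ≈ p
  scale-one p = coeffwise λ i → trans (coeff-scale 1ℚ p i) (ℚ.*-identityˡ (coeff p i))

open Coefficientwise public

module ≈-Reasoning = SetoidReasoning ≈-setoid

⊕-isSemigroup : IsSemigroup _≈_ _⊕_
⊕-isSemigroup = record
  { isMagma = record { isEquivalence = ≈-isEquivalence ; ∙-cong = ⊕-cong }
  ; assoc   = ⊕-assoc }

⊕-commutativeSemigroup : CommutativeSemigroup 0ℓ 0ℓ
⊕-commutativeSemigroup = record
  { isCommutativeSemigroup = record { isSemigroup = ⊕-isSemigroup ; comm = ⊕-comm } }

open import Algebra.Properties.CommutativeSemigroup ⊕-commutativeSemigroup
  using () renaming (interchange to ⊕-interchange; x∙yz≈y∙xz to ⊕-leftComm)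

-- Multiplication.  Since ⊛ recurses on its left argument, commutativity is
-- proved first and used to transport every left-hand law to the right.
module Multiplication where
  open ≈-Reasoning

  zero-cons : ∀ {p} → p ≈ [] → (0ℚ ∷ p) ≈ []
  zero-cons p≈0 = coeffwise λ { zero → refl ; (suc i) → at p≈0 i }

  shift-⊕ : ∀ p q → (0ℚ ∷ (p ⊕ q)) ≈ ((0ℚ ∷ p) ⊕ (0ℚ ∷ q))
  shift-⊕ p q = cons-cong (sym (ℚ.+-identityˡ 0ℚ)) ≈-refl

  ⊛-zeroʳ : ∀ p → (p ⊛ []) ≈ []
  ⊛-zeroʳ []      = ≈-refl
  ⊛-zeroʳ (a ∷ p) = zero-cons (⊛-zeroʳ p)

  ⊛-vanishˡ : ∀ p q → p ≈ [] → (p ⊛ q) ≈ []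
  ⊛-vanishˡ []      q h = ≈-refl
  ⊛-vanishˡ (a ∷ p) q h = begin
    scale a q ⊕ (0ℚ ∷ (p ⊛ q))   ≈⟨ ⊕-cong (≈-reflexive (cong (λ c → scale c q) (at h zero))) (cons-cong refl tail≈0) ⟩
    scale 0ℚ q ⊕ (0ℚ ∷ [])       ≈⟨ ⊕-cong (scale-zero q) (zero-cons ≈-refl) ⟩
    []                           ∎
    where
    tail≈0 : (p ⊛ q) ≈ []
    tail≈0 = ⊛-vanishˡ p q (coeffwise λ i → at h (suc i))

  ⊛-congˡ : ∀ {p p′} q → p ≈ p′ → (p ⊛ q) ≈ (p′ ⊛ q)
  ⊛-congˡ {[]}    {p′}     q h = ≈-sym (⊛-vanishˡ p′ q (≈-sym h))
  ⊛-congˡ {a ∷ p} {[]}     q h = ⊛-vanishˡ (a ∷ p) q h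
  ⊛-congˡ {a ∷ p} {b ∷ p′} q h with at h zero
  ... | refl = ⊕-cong ≈-refl (cons-cong refl (⊛-congˡ {p} {p′} q (coeffwise λ i → at h (suc i))))

  ⊛-comm : ∀ p q → (p ⊛ q) ≈ (q ⊛ p)
  ⊛-comm []      q       = ≈-sym (⊛-zeroʳ q)
  ⊛-comm (a ∷ p) []      = ⊛-zeroʳ (a ∷ p)
  ⊛-comm (a ∷ p) (b ∷ q) = cons-cong (cong (_+ 0ℚ) (ℚ.*-comm a b)) (begin
    scale a q ⊕ (p ⊛ (b ∷ q))                ≈⟨ ⊕-cong ≈-refl (⊛-comm p (b ∷ q)) ⟩
    scale a q ⊕ (scale b p ⊕ (0ℚ ∷ (q ⊛ p))) ≈⟨ ⊕-leftComm (scale a q) (scale b p) _ ⟩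
    scale b p ⊕ (scale a q ⊕ (0ℚ ∷ (q ⊛ p))) ≈⟨ ⊕-cong (≈-refl {scale b p}) (⊕-cong (≈-refl {scale a q}) (cons-cong refl (⊛-comm q p))) ⟩
    scale b p ⊕ (scale a q ⊕ (0ℚ ∷ (p ⊛ q))) ≈⟨ ⊕-cong ≈-refl (⊛-comm q (a ∷ p)) ⟨
    scale b p ⊕ (q ⊛ (a ∷ p))                ∎)

  ⊛-congʳ : ∀ p {q q′} → q ≈ q′ → (p ⊛ q) ≈ (p ⊛ q′)
  ⊛-congʳ p {q} {q′} h = ≈-trans (⊛-comm p q) (≈-trans (⊛-congˡ p h) (⊛-comm q′ p))

  ⊛-cong : ∀ {p p′ q q′} → p ≈ p′ → q ≈ q′ → (p ⊛ q) ≈ (p′ ⊛ q′)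
  ⊛-cong {p′ = p′} {q = q} h k = ≈-trans (⊛-congˡ q h) (⊛-congʳ p′ k)

  ⊛-distribˡ : ∀ p q r → (p ⊛ (q ⊕ r)) ≈ ((p ⊛ q) ⊕ (p ⊛ r))
  ⊛-distribˡ []      q r = ≈-refl
  ⊛-distribˡ (a ∷ p) q r = begin
    scale a (q ⊕ r) ⊕ (0ℚ ∷ (p ⊛ (q ⊕ r)))
      ≈⟨ ⊕-cong (scale-distrib-⊕ a q r) (cons-cong refl (⊛-distribˡ p q r)) ⟩
    (scale a q ⊕ scale a r) ⊕ (0ℚ ∷ ((p ⊛ q) ⊕ (p ⊛ r)))
      ≈⟨ ⊕-cong ≈-refl (shift-⊕ (p ⊛ q) (p ⊛ r)) ⟩
    (scale a q ⊕ scale a r) ⊕ ((0ℚ ∷ (p ⊛ q)) ⊕ (0ℚ ∷ (p ⊛ r)))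
      ≈⟨ ⊕-interchange (scale a q) (scale a r) _ _ ⟩
    (scale a q ⊕ (0ℚ ∷ (p ⊛ q))) ⊕ (scale a r ⊕ (0ℚ ∷ (p ⊛ r))) ∎

  ⊛-distribʳ : ∀ r p q → ((p ⊕ q) ⊛ r) ≈ ((p ⊛ r) ⊕ (q ⊛ r))
  ⊛-distribʳ r p q = begin
    (p ⊕ q) ⊛ r       ≈⟨ ⊛-comm (p ⊕ q) r ⟩
    r ⊛ (p ⊕ q)       ≈⟨ ⊛-distribˡ r p q ⟩
    (r ⊛ p) ⊕ (r ⊛ q) ≈⟨ ⊕-cong (⊛-comm r p) (⊛-comm r q) ⟩
    (p ⊛ r) ⊕ (q ⊛ r) ∎

  scale-⊛ : ∀ c p q → (scale c p ⊛ q) ≈ scale c (p ⊛ q)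
  scale-⊛ c []      q = ≈-refl
  scale-⊛ c (a ∷ p) q = begin
    scale (c * a) q ⊕ (0ℚ ∷ (scale c p ⊛ q))
      ≈⟨ ⊕-cong (scale-assoc c a q) (cons-cong (sym (ℚ.*-zeroʳ c)) (scale-⊛ c p q)) ⟩
    scale c (scale a q) ⊕ scale c (0ℚ ∷ (p ⊛ q))
      ≈⟨ scale-distrib-⊕ c (scale a q) _ ⟨
    scale c (scale a q ⊕ (0ℚ ∷ (p ⊛ q))) ∎

  ⊛-assoc : ∀ p q r → ((p ⊛ q) ⊛ r) ≈ (p ⊛ (q ⊛ r))
  ⊛-assoc []      q r = ≈-refl
  ⊛-assoc (a ∷ p) q r = begin
    (scale a q ⊕ (0ℚ ∷ (p ⊛ q))) ⊛ r        ≈⟨ ⊛-distribʳ r (scale a q) _ ⟩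
    (scale a q ⊛ r) ⊕ ((0ℚ ∷ (p ⊛ q)) ⊛ r)  ≈⟨ ⊕-cong (scale-⊛ a q r) shift-⊛ ⟩
    scale a (q ⊛ r) ⊕ (0ℚ ∷ ((p ⊛ q) ⊛ r))  ≈⟨ ⊕-cong ≈-refl (cons-cong refl (⊛-assoc p q r)) ⟩
    scale a (q ⊛ r) ⊕ (0ℚ ∷ (p ⊛ (q ⊛ r)))  ∎
    where
    shift-⊛ : ((0ℚ ∷ (p ⊛ q)) ⊛ r) ≈ (0ℚ ∷ ((p ⊛ q) ⊛ r))
    shift-⊛ = ⊕-cong (scale-zero r) ≈-refl

  ⊛-identityˡ : ∀ p → (oneP ⊛ p) ≈ p
  ⊛-identityˡ p = begin
    scale 1ℚ p ⊕ (0ℚ ∷ []) ≈⟨ ⊕-cong (scale-one p) (zero-cons ≈-refl) ⟩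
    p ⊕ []                 ≈⟨ ⊕-identityʳ p ⟩
    p                      ∎

  scale-as-⊛ : ∀ c p → scale c p ≈ (constP c ⊛ p)
  scale-as-⊛ c p = ≈-sym (≈-trans (⊕-cong ≈-refl (zero-cons ≈-refl)) (⊕-identityʳ (scale c p)))

  ⊛-scale : ∀ c p q → (p ⊛ scale c q) ≈ scale c (p ⊛ q)
  ⊛-scale c p q = begin
    p ⊛ scale c q   ≈⟨ ⊛-comm p (scale c q) ⟩
    scale c q ⊛ p   ≈⟨ scale-⊛ c q p ⟩
    scale c (q ⊛ p) ≈⟨ scale-cong c (⊛-comm q p) ⟩
    scale c (p ⊛ q) ∎

open Multiplication public

PolyRing : CommutativeRing 0ℓ 0ℓ
PolyRing = record
  { Carrier = Poly ; _≈_ = _≈_ ; _+_ = _⊕_ ; _*_ = _⊛_ ; -_ = ⊖_ ; 0# = [] ; 1# = oneP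
  ; isCommutativeRing = record
    { isRing = record
      { +-isAbelianGroup = record
        { isGroup = record
          { isMonoid = record
            { isSemigroup = ⊕-isSemigroup
            ; identity    = (λ _ → ≈-refl) , ⊕-identityʳ }
          ; inverse = (λ p → ≈-trans (⊕-comm (⊖ p) p) (⊖-inverseʳ p)) , ⊖-inverseʳ
          ; ⁻¹-cong = scale-cong (- 1ℚ) }
        ; comm = ⊕-comm }
      ; *-cong     = ⊛-cong
      ; *-assoc    = ⊛-assoc
      ; *-identity = ⊛-identityˡ , (λ p → ≈-trans (⊛-comm p oneP) (⊛-identityˡ p))
      ; distrib    = ⊛-distribˡ , ⊛-distribʳ }
    ; *-comm = ⊛-comm } }

-- The ring solver, instantiated at ℚ[t], discharges identities between
-- polynomial expressions.  It needs a (partial) zero test on coefficients.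
zero? : ∀ p → Maybe ([] ≈ p)
zero? []      = just ≈-refl
zero? (a ∷ p) with 0ℚ ℚ.≟ a | zero? p
... | yes 0≡a | just 0≈p = just (coeffwise λ { zero → 0≡a ; (suc i) → at 0≈p i })
... | _       | _        = nothing

PolyRing-solver : AlmostCommutativeRing 0ℓ 0ℓ
PolyRing-solver = fromCommutativeRing PolyRing zero?

module Modulo (M : Poly) where
  open ≈-Reasoning

  infix 4 _∼_
  record _∼_ (P Q : Poly) : Set where
    constructor multiple
    field
      quotient   : Poly
      difference : (P ⊕ (⊖ Q)) ≈ (M ⊛ quotient)

  ∼⇒≡mod : ∀ {P Q} → P ∼ Q → P ≡ Q [mod M ]
  ∼⇒≡mod (multiple R P−Q≈MR) = R , at P−Q≈MR

  ≈⇒∼ : ∀ {P Q} → P ≈ Q → P ∼ Q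
  ≈⇒∼ {P} {Q} P≈Q = multiple [] (begin
    P ⊕ (⊖ Q) ≈⟨ ⊕-cong P≈Q ≈-refl ⟩
    Q ⊕ (⊖ Q) ≈⟨ ⊖-inverseʳ Q ⟩
    []        ≈⟨ ⊛-zeroʳ M ⟨
    M ⊛ []    ∎)

  ∼-refl : ∀ {P} → P ∼ P
  ∼-refl = ≈⇒∼ ≈-refl

  ∼-sym : ∀ {P Q} → P ∼ Q → Q ∼ P
  ∼-sym {P} {Q} (multiple R P−Q≈MR) = multiple (⊖ R) (begin
    Q ⊕ (⊖ P)     ≈⟨ negate-difference P Q ⟩
    ⊖ (P ⊕ (⊖ Q)) ≈⟨ scale-cong (- 1ℚ) P−Q≈MR ⟩
    ⊖ (M ⊛ R)     ≈⟨ negate-multiple M R ⟩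
    M ⊛ (⊖ R)     ∎)
    where
    negate-difference : ∀ P Q → (Q ⊕ (⊖ P)) ≈ (⊖ (P ⊕ (⊖ Q)))
    negate-difference = solve-∀ PolyRing-solver
    negate-multiple : ∀ M R → (⊖ (M ⊛ R)) ≈ (M ⊛ (⊖ R))
    negate-multiple = solve-∀ PolyRing-solver

  ∼-trans : ∀ {P Q S} → P ∼ Q → Q ∼ S → P ∼ S
  ∼-trans {P} {Q} {S} (multiple R₁ P−Q≈MR₁) (multiple R₂ Q−S≈MR₂) = multiple (R₁ ⊕ R₂) (begin
    P ⊕ (⊖ S)                 ≈⟨ telescope P Q S ⟩
    (P ⊕ (⊖ Q)) ⊕ (Q ⊕ (⊖ S)) ≈⟨ ⊕-cong P−Q≈MR₁ Q−S≈MR₂ ⟩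
    (M ⊛ R₁) ⊕ (M ⊛ R₂)       ≈⟨ ⊛-distribˡ M R₁ R₂ ⟨
    M ⊛ (R₁ ⊕ R₂)             ∎)
    where
    telescope : ∀ P Q S → (P ⊕ (⊖ S)) ≈ ((P ⊕ (⊖ Q)) ⊕ (Q ⊕ (⊖ S)))
    telescope = solve-∀ PolyRing-solver

  ∼-⊕ : ∀ {P Q X Y} → P ∼ Q → X ∼ Y → (P ⊕ X) ∼ (Q ⊕ Y)
  ∼-⊕ {P} {Q} {X} {Y} (multiple R₁ P−Q≈MR₁) (multiple R₂ X−Y≈MR₂) = multiple (R₁ ⊕ R₂) (begin
    (P ⊕ X) ⊕ (⊖ (Q ⊕ Y))     ≈⟨ regroup P Q X Y ⟩
    (P ⊕ (⊖ Q)) ⊕ (X ⊕ (⊖ Y)) ≈⟨ ⊕-cong P−Q≈MR₁ X−Y≈MR₂ ⟩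
    (M ⊛ R₁) ⊕ (M ⊛ R₂)       ≈⟨ ⊛-distribˡ M R₁ R₂ ⟨
    M ⊛ (R₁ ⊕ R₂)             ∎)
    where
    regroup : ∀ P Q X Y → ((P ⊕ X) ⊕ (⊖ (Q ⊕ Y))) ≈ ((P ⊕ (⊖ Q)) ⊕ (X ⊕ (⊖ Y)))
    regroup = solve-∀ PolyRing-solver

  -- PX − QY = (P − Q)X + Q(X − Y)
  ∼-⊛ : ∀ {P Q X Y} → P ∼ Q → X ∼ Y → (P ⊛ X) ∼ (Q ⊛ Y)
  ∼-⊛ {P} {Q} {X} {Y} (multiple R₁ P−Q≈MR₁) (multiple R₂ X−Y≈MR₂) =
    multiple ((R₁ ⊛ X) ⊕ (Q ⊛ R₂)) (begin
      (P ⊛ X) ⊕ (⊖ (Q ⊛ Y))                 ≈⟨ split-product P Q X Y ⟩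
      ((P ⊕ (⊖ Q)) ⊛ X) ⊕ (Q ⊛ (X ⊕ (⊖ Y))) ≈⟨ ⊕-cong (⊛-congˡ X P−Q≈MR₁) (⊛-congʳ Q X−Y≈MR₂) ⟩
      ((M ⊛ R₁) ⊛ X) ⊕ (Q ⊛ (M ⊛ R₂))       ≈⟨ factor-M M R₁ X Q R₂ ⟩
      M ⊛ ((R₁ ⊛ X) ⊕ (Q ⊛ R₂))             ∎)
    where
    split-product : ∀ P Q X Y → ((P ⊛ X) ⊕ (⊖ (Q ⊛ Y))) ≈ (((P ⊕ (⊖ Q)) ⊛ X) ⊕ (Q ⊛ (X ⊕ (⊖ Y))))
    split-product = solve-∀ PolyRing-solver
    factor-M : ∀ M R₁ X Q R₂ → (((M ⊛ R₁) ⊛ X) ⊕ (Q ⊛ (M ⊛ R₂))) ≈ (M ⊛ ((R₁ ⊛ X) ⊕ (Q ⊛ R₂)))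
    factor-M = solve-∀ PolyRing-solver

  ∼-scale : ∀ c {X Y} → X ∼ Y → scale c X ∼ scale c Y
  ∼-scale c {X} {Y} X∼Y =
    ∼-trans (≈⇒∼ (scale-as-⊛ c X)) (∼-trans (∼-⊛ (∼-refl {constP c}) X∼Y) (≈⇒∼ (≈-sym (scale-as-⊛ c Y))))

  ∼-isPreorder : IsPreorder _≈_ _∼_
  ∼-isPreorder = record { isEquivalence = ≈-isEquivalence ; reflexive = ≈⇒∼ ; trans = ∼-trans }

module Compatible
  (_R_ : Poly → Poly → Set)
  (R-refl  : ∀ {p} → p R p)
  (R-⊕     : ∀ {p p′ q q′} → p R p′ → q R q′ → (p ⊕ q) R (p′ ⊕ q′))
  (R-⊛     : ∀ {p p′ q q′} → p R p′ → q R q′ → (p ⊛ q) R (p′ ⊛ q′))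
  (R-scale : ∀ c {p q} → p R q → scale c p R scale c q)
  where

  ^P-compat : ∀ n {p q} → p R q → (p ^P n) R (q ^P n)
  ^P-compat zero    pRq = R-refl
  ^P-compat (suc n) pRq = R-⊛ pRq (^P-compat n pRq)

  prodP-compat : ∀ n {f f′ : Fin n → Poly} → (∀ r → f r R f′ r) → prodP n f R prodP n f′
  prodP-compat zero    fRf′ = R-refl
  prodP-compat (suc n) fRf′ = R-⊛ (fRf′ zero) (prodP-compat n (λ r → fRf′ (suc r)))

  evalM-compat : ∀ {N} (F : MPoly N) {u u′ v v′ : Fin N → Poly} →
    (∀ r → u r R u′ r) → (∀ r → v r R v′ r) → evalM F u v R evalM F u′ v′
  evalM-compat []                    uRu′ vRv′ = R-refl
  evalM-compat {N} ((c , a , b) ∷ F) uRu′ vRv′ =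
    R-⊕ (R-scale c (prodP-compat N λ r →
           R-⊛ (^P-compat (lookup a r) (uRu′ r)) (^P-compat (lookup b r) (vRv′ r))))
        (evalM-compat F uRu′ vRv′)

  compose-compat : ∀ P {Q Q′} → Q R Q′ → compose P Q R compose P Q′
  compose-compat []      QRQ′ = R-refl
  compose-compat (a ∷ P) QRQ′ = R-⊕ R-refl (R-⊛ QRQ′ (compose-compat P QRQ′))

open Compatible _≈_ ≈-refl ⊕-cong ⊛-cong scale-cong
  using () renaming (^P-compat to ^P-cong; prodP-compat to prodP-cong)

-- Powers in ℚ[t] agree with the powers of the ring PolyRing, so the
-- library's laws of exponents apply.
module Powers where
  open import Algebra.Properties.Semiring.Exp (CommutativeRing.semiring PolyRing)
    using (_^_; ^-assocʳ)
  open ≈-Reasoning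

  ^P≡^ : ∀ p n → p ^P n ≡ p ^ n
  ^P≡^ p zero    = refl
  ^P≡^ p (suc n) = cong (p ⊛_) (^P≡^ p n)

  ^P-assocʳ : ∀ p m n → ((p ^P m) ^P n) ≈ (p ^P (m *ℕ n))
  ^P-assocʳ p m n = begin
    (p ^P m) ^P n ≡⟨ trans (cong (_^P n) (^P≡^ p m)) (^P≡^ (p ^ m) n) ⟩
    (p ^ m) ^ n   ≈⟨ ^-assocʳ p m n ⟩
    p ^ (m *ℕ n)  ≡⟨ ^P≡^ p (m *ℕ n) ⟨
    p ^P (m *ℕ n) ∎

open Powers using (^P-assocʳ)

module Composition where
  open ≈-Reasoning

  compose-⊕ : ∀ P Q R → compose (P ⊕ Q) R ≈ (compose P R ⊕ compose Q R)
  compose-⊕ []      Q       R = ≈-refl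
  compose-⊕ (a ∷ P) []      R = ≈-sym (⊕-identityʳ _)
  compose-⊕ (a ∷ P) (b ∷ Q) R = begin
    constP (a + b) ⊕ (R ⊛ compose (P ⊕ Q) R)
      ≈⟨ ⊕-cong ≈-refl (⊛-congʳ R (compose-⊕ P Q R)) ⟩
    constP (a + b) ⊕ (R ⊛ (compose P R ⊕ compose Q R))
      ≈⟨ ⊕-cong ≈-refl (⊛-distribˡ R _ _) ⟩
    (constP a ⊕ constP b) ⊕ ((R ⊛ compose P R) ⊕ (R ⊛ compose Q R))
      ≈⟨ ⊕-interchange (constP a) (constP b) (R ⊛ compose P R) (R ⊛ compose Q R) ⟩
    (constP a ⊕ (R ⊛ compose P R)) ⊕ (constP b ⊕ (R ⊛ compose Q R)) ∎

  compose-scale : ∀ c P R → compose (scale c P) R ≈ scale c (compose P R)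
  compose-scale c []      R = ≈-refl
  compose-scale c (a ∷ P) R = begin
    constP (c * a) ⊕ (R ⊛ compose (scale c P) R)
      ≈⟨ ⊕-cong ≈-refl (⊛-congʳ R (compose-scale c P R)) ⟩
    constP (c * a) ⊕ (R ⊛ scale c (compose P R))
      ≈⟨ ⊕-cong ≈-refl (⊛-scale c R _) ⟩
    scale c (constP a) ⊕ scale c (R ⊛ compose P R)
      ≈⟨ scale-distrib-⊕ c (constP a) (R ⊛ compose P R) ⟨
    scale c (constP a ⊕ (R ⊛ compose P R)) ∎

  compose-⊛ : ∀ P Q R → compose (P ⊛ Q) R ≈ (compose P R ⊛ compose Q R)
  compose-⊛ []      Q R = ≈-refl
  compose-⊛ (a ∷ P) Q R = begin
    compose (scale a Q ⊕ (0ℚ ∷ (P ⊛ Q))) R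
      ≈⟨ compose-⊕ (scale a Q) _ R ⟩
    compose (scale a Q) R ⊕ (constP 0ℚ ⊕ (R ⊛ compose (P ⊛ Q) R))
      ≈⟨ ⊕-cong (≈-trans (compose-scale a Q R) (scale-as-⊛ a _))
                (⊕-cong (zero-cons ≈-refl) (⊛-congʳ R (compose-⊛ P Q R))) ⟩
    (constP a ⊛ Q∘R) ⊕ ([] ⊕ (R ⊛ (compose P R ⊛ Q∘R)))
      ≈⟨ factor-right (constP a) Q∘R R (compose P R) ⟩
    (constP a ⊕ (R ⊛ compose P R)) ⊛ Q∘R ∎
    where
    Q∘R = compose Q R
    factor-right : ∀ A X R C → ((A ⊛ X) ⊕ (R ⊛ (C ⊛ X))) ≈ ((A ⊕ (R ⊛ C)) ⊛ X)
    factor-right = solve-∀ PolyRing-solver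

  compose-const : ∀ c R → compose (constP c) R ≈ constP c
  compose-const c R = ≈-trans (⊕-cong ≈-refl (⊛-zeroʳ R)) (⊕-identityʳ (constP c))

  compose-^P : ∀ P n R → compose (P ^P n) R ≈ (compose P R ^P n)
  compose-^P P zero    R = compose-const 1ℚ R
  compose-^P P (suc n) R = ≈-trans (compose-⊛ P (P ^P n) R) (⊛-congʳ (compose P R) (compose-^P P n R))

  compose-prodP : ∀ n (f : Fin n → Poly) R → compose (prodP n f) R ≈ prodP n (λ r → compose (f r) R)
  compose-prodP zero    f R = compose-const 1ℚ R
  compose-prodP (suc n) f R =
    ≈-trans (compose-⊛ (f zero) _ R) (⊛-congʳ (compose (f zero) R) (compose-prodP n (λ r → f (suc r)) R))

  compose-evalM : ∀ {N} (F : MPoly N) u v R →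
    compose (evalM F u v) R ≈ evalM F (λ r → compose (u r) R) (λ r → compose (v r) R)
  compose-evalM []                u v R = ≈-refl
  compose-evalM {N} ((c , a , b) ∷ F) u v R = begin
    compose (scale c (prodP N monomial) ⊕ evalM F u v) R
      ≈⟨ compose-⊕ (scale c (prodP N monomial)) (evalM F u v) R ⟩
    compose (scale c (prodP N monomial)) R ⊕ compose (evalM F u v) R
      ≈⟨ ⊕-cong (compose-scale c (prodP N monomial) R) (compose-evalM F u v R) ⟩
    scale c (compose (prodP N monomial) R) ⊕ evalM F u∘R v∘R
      ≈⟨ ⊕-cong (scale-cong c (≈-trans (compose-prodP N monomial R) (prodP-cong N substitute))) ≈-refl ⟩
    scale c (prodP N λ r → (u∘R r ^P lookup a r) ⊛ (v∘R r ^P lookup b r)) ⊕ evalM F u∘R v∘R ∎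
    where
    monomial : Fin N → Poly
    monomial r = (u r ^P lookup a r) ⊛ (v r ^P lookup b r)
    u∘R v∘R : Fin N → Poly
    u∘R r = compose (u r) R
    v∘R r = compose (v r) R
    substitute : ∀ r → compose (monomial r) R ≈ ((u∘R r ^P lookup a r) ⊛ (v∘R r ^P lookup b r))
    substitute r = ≈-trans (compose-⊛ (u r ^P lookup a r) _ R)
                           (⊛-cong (compose-^P (u r) (lookup a r) R) (compose-^P (v r) (lookup b r) R))

  compose-tˡ : ∀ R → compose tP R ≈ R
  compose-tˡ R = begin
    constP 0ℚ ⊕ (R ⊛ compose oneP R) ≈⟨ ⊕-cong (zero-cons ≈-refl) (⊛-congʳ R (compose-const 1ℚ R)) ⟩
    R ⊛ oneP                         ≈⟨ ⊛-comm R oneP ⟩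
    oneP ⊛ R                         ≈⟨ ⊛-identityˡ R ⟩
    R                                ∎

  compose-tʳ : ∀ P → compose P tP ≈ P
  compose-tʳ []      = ≈-refl
  compose-tʳ (a ∷ P) = begin
    constP a ⊕ (tP ⊛ compose P tP) ≈⟨ ⊕-cong (≈-refl {constP a}) (⊕-cong (scale-zero P∘t) (cons-cong refl (⊛-identityˡ P∘t))) ⟩
    constP a ⊕ (0ℚ ∷ compose P tP) ≈⟨ cons-cong (ℚ.+-identityʳ a) (compose-tʳ P) ⟩
    a ∷ P                          ∎
    where P∘t = compose P tP

  compose-assoc : ∀ P Q R → compose (compose P Q) R ≈ compose P (compose Q R)
  compose-assoc []      Q R = ≈-refl
  compose-assoc (a ∷ P) Q R = begin
    compose (constP a ⊕ (Q ⊛ compose P Q)) R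
      ≈⟨ compose-⊕ (constP a) (Q ⊛ compose P Q) R ⟩
    compose (constP a) R ⊕ compose (Q ⊛ compose P Q) R
      ≈⟨ ⊕-cong (compose-const a R) (compose-⊛ Q _ R) ⟩
    constP a ⊕ (compose Q R ⊛ compose (compose P Q) R)
      ≈⟨ ⊕-cong ≈-refl (⊛-congʳ (compose Q R) (compose-assoc P Q R)) ⟩
    constP a ⊕ (compose Q R ⊛ compose P (compose Q R)) ∎

open Composition

-- The value of a term list depends only on its monomial coefficients, i.e.
-- evaluation is well defined on ℚ[x, y].  The proof removes one monomial at
-- a time from both lists.

SameCoefficients : ∀ {N} → MPoly N → MPoly N → Set
SameCoefficients F F′ = ∀ a b → mcoeff F a b ≡ mcoeff F′ a b

drop : ∀ {N} → Vec ℕ N → Vec ℕ N → MPoly N → MPoly N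
drop a b []                    = []
drop a b ((c , a′ , b′) ∷ F) with ≡-dec ℕ._≟_ a′ a ×-dec ≡-dec ℕ._≟_ b′ b
... | yes _ = drop a b F
... | no  _ = (c , a′ , b′) ∷ drop a b F

drop-length : ∀ {N} (a b : Vec ℕ N) F → length (drop a b F) ≤ length F
drop-length a b []                  = z≤n
drop-length a b ((c , a′ , b′) ∷ F) with ≡-dec ℕ._≟_ a′ a ×-dec ≡-dec ℕ._≟_ b′ b
... | yes _ = ℕ.m≤n⇒m≤1+n (drop-length a b F)
... | no  _ = s≤s (drop-length a b F)

drop-head-length : ∀ {N} c (a b : Vec ℕ N) F → length (drop a b ((c , a , b) ∷ F)) ≤ length F
drop-head-length c a b F with ≡-dec ℕ._≟_ a a ×-dec ≡-dec ℕ._≟_ b b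
... | yes _    = drop-length a b F
... | no  a≢a = ⊥-elim (a≢a (refl , refl))

mcoeff-drop-same : ∀ {N} (a b : Vec ℕ N) F → mcoeff (drop a b F) a b ≡ 0ℚ
mcoeff-drop-same a b []                  = refl
mcoeff-drop-same a b ((c , a′ , b′) ∷ F) with ≡-dec ℕ._≟_ a′ a ×-dec ≡-dec ℕ._≟_ b′ b
... | yes _     = mcoeff-drop-same a b F
-- the kept term is tested again by mcoeff, with the known outcome
... | no  ab′≢ab with ≡-dec ℕ._≟_ a′ a ×-dec ≡-dec ℕ._≟_ b′ b
...   | yes ab′≡ab = ⊥-elim (ab′≢ab ab′≡ab)
...   | no  _      = mcoeff-drop-same a b F

mcoeff-drop-other : ∀ {N} (a b a₁ b₁ : Vec ℕ N) F → ¬ (a₁ ≡ a × b₁ ≡ b) →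
  mcoeff (drop a b F) a₁ b₁ ≡ mcoeff F a₁ b₁
mcoeff-drop-other a b a₁ b₁ []                  _ = refl
mcoeff-drop-other a b a₁ b₁ ((c , a′ , b′) ∷ F) ab₁≢ab with ≡-dec ℕ._≟_ a′ a ×-dec ≡-dec ℕ._≟_ b′ b
... | yes (refl , refl) with ≡-dec ℕ._≟_ a a₁ ×-dec ≡-dec ℕ._≟_ b b₁
...   | yes (refl , refl) = ⊥-elim (ab₁≢ab (refl , refl))
...   | no  _             = mcoeff-drop-other a b a₁ b₁ F ab₁≢ab
mcoeff-drop-other a b a₁ b₁ ((c , a′ , b′) ∷ F) ab₁≢ab | no _
  with ≡-dec ℕ._≟_ a′ a₁ ×-dec ≡-dec ℕ._≟_ b′ b₁
...   | yes _ = cong (c +_) (mcoeff-drop-other a b a₁ b₁ F ab₁≢ab)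
...   | no  _ = mcoeff-drop-other a b a₁ b₁ F ab₁≢ab

drop-SameCoefficients : ∀ {N} (a b : Vec ℕ N) F F′ → SameCoefficients F F′ →
  SameCoefficients (drop a b F) (drop a b F′)
drop-SameCoefficients a b F F′ same a₁ b₁ with ≡-dec ℕ._≟_ a₁ a ×-dec ≡-dec ℕ._≟_ b₁ b
... | yes (refl , refl) = trans (mcoeff-drop-same a b F) (sym (mcoeff-drop-same a b F′))
... | no  ab₁≢ab        = begin
  mcoeff (drop a b F) a₁ b₁  ≡⟨ mcoeff-drop-other a b a₁ b₁ F ab₁≢ab ⟩
  mcoeff F a₁ b₁             ≡⟨ same a₁ b₁ ⟩
  mcoeff F′ a₁ b₁            ≡⟨ mcoeff-drop-other a b a₁ b₁ F′ ab₁≢ab ⟨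
  mcoeff (drop a b F′) a₁ b₁ ∎
  where open ≡-Reasoning

module Evaluation {N : ℕ} (u v : Fin N → Poly) where
  open ≈-Reasoning

  monomial : Vec ℕ N → Vec ℕ N → Poly
  monomial a b = prodP N (λ r → (u r ^P lookup a r) ⊛ (v r ^P lookup b r))

  evalM-split : ∀ a b F → evalM F u v ≈ (scale (mcoeff F a b) (monomial a b) ⊕ evalM (drop a b F) u v)
  evalM-split a b [] = ≈-sym (≈-trans (⊕-identityʳ _) (scale-zero (monomial a b)))
  evalM-split a b ((c , a′ , b′) ∷ F) with ≡-dec ℕ._≟_ a′ a ×-dec ≡-dec ℕ._≟_ b′ b
  ... | yes (refl , refl) = begin
    scale c (monomial a b) ⊕ evalM F u v
      ≈⟨ ⊕-cong ≈-refl (evalM-split a b F) ⟩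
    scale c (monomial a b) ⊕ (scale m (monomial a b) ⊕ rest)
      ≈⟨ ⊕-assoc (scale c (monomial a b)) (scale m (monomial a b)) rest ⟨
    (scale c (monomial a b) ⊕ scale m (monomial a b)) ⊕ rest
      ≈⟨ ⊕-cong (scale-distrib-+ c m (monomial a b)) ≈-refl ⟨
    scale (c + m) (monomial a b) ⊕ rest ∎
    where
    m : ℚ
    m = mcoeff F a b
    rest : Poly
    rest = evalM (drop a b F) u v
  ... | no _ = begin
    scale c (monomial a′ b′) ⊕ evalM F u v
      ≈⟨ ⊕-cong ≈-refl (evalM-split a b F) ⟩
    scale c (monomial a′ b′) ⊕ (scale (mcoeff F a b) (monomial a b) ⊕ evalM (drop a b F) u v)
      ≈⟨ ⊕-leftComm (scale c (monomial a′ b′)) (scale (mcoeff F a b) (monomial a b)) _ ⟩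
    scale (mcoeff F a b) (monomial a b) ⊕ (scale c (monomial a′ b′) ⊕ evalM (drop a b F) u v) ∎

  evalM-remove : ∀ a b F F′ → evalM (drop a b F) u v ≈ evalM (drop a b F′) u v →
    SameCoefficients F F′ → evalM F u v ≈ evalM F′ u v
  evalM-remove a b F F′ rest≈ same = begin
    evalM F u v                                                    ≈⟨ evalM-split a b F ⟩
    scale (mcoeff F a b) (monomial a b) ⊕ evalM (drop a b F) u v
      ≈⟨ ⊕-cong (≈-reflexive (cong (λ x → scale x (monomial a b)) (same a b))) rest≈ ⟩
    scale (mcoeff F′ a b) (monomial a b) ⊕ evalM (drop a b F′) u v ≈⟨ evalM-split a b F′ ⟨
    evalM F′ u v                                                   ∎

  -- Induction on a bound n for the total length of the two lists; each step
  -- removes the monomial of a first term from both lists.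
  evalM-coefficients′ : ∀ n F F′ → length F +ℕ length F′ ≤ n →
    SameCoefficients F F′ → evalM F u v ≈ evalM F′ u v
  evalM-coefficients′ _       []                 []                   _          _    = ≈-refl
  evalM-coefficients′ (suc n) F@((c , a , b) ∷ G) F′                  (s≤s size) same =
    evalM-remove a b F F′ (evalM-coefficients′ n (drop a b F) (drop a b F′)
      (ℕ.≤-trans (ℕ.+-mono-≤ (drop-head-length c a b G) (drop-length a b F′)) size)
      (drop-SameCoefficients a b F F′ same)) same
  evalM-coefficients′ (suc n) []                 F′@((c , a , b) ∷ G) (s≤s size) same =
    evalM-remove a b [] F′ (evalM-coefficients′ n [] (drop a b F′)
      (ℕ.≤-trans (drop-head-length c a b G) size)
      (drop-SameCoefficients a b [] F′ same)) same

  evalM-coefficients : ∀ F F′ → SameCoefficients F F′ → evalM F u v ≈ evalM F′ u v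
  evalM-coefficients F F′ = evalM-coefficients′ _ F F′ ℕ.≤-refl

open Evaluation using (evalM-coefficients)

swapTerms : ∀ {N} → MPoly N → MPoly N
swapTerms []                = []
swapTerms ((c , a , b) ∷ F) = (c , b , a) ∷ swapTerms F

mcoeff-swapTerms : ∀ {N} (F : MPoly N) a b → mcoeff (swapTerms F) a b ≡ mcoeff F b a
mcoeff-swapTerms []                  a b = refl
mcoeff-swapTerms ((c , a′ , b′) ∷ F) a b
  with ≡-dec ℕ._≟_ b′ a ×-dec ≡-dec ℕ._≟_ a′ b | ≡-dec ℕ._≟_ a′ b ×-dec ≡-dec ℕ._≟_ b′ a
... | yes _             | yes _             = cong (c +_) (mcoeff-swapTerms F a b)
... | no  _             | no  _             = mcoeff-swapTerms F a b
... | yes (b′≡a , a′≡b) | no  mismatch      = ⊥-elim (mismatch (a′≡b , b′≡a))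
... | no  mismatch      | yes (a′≡b , b′≡a) = ⊥-elim (mismatch (b′≡a , a′≡b))

evalM-swapTerms : ∀ {N} (F : MPoly N) u v → evalM F v u ≈ evalM (swapTerms F) u v
evalM-swapTerms []                    u v = ≈-refl
evalM-swapTerms {N} ((c , a , b) ∷ F) u v =
  ⊕-cong (scale-cong c (prodP-cong N λ r → ⊛-comm (v r ^P lookup a r) (u r ^P lookup b r)))
         (evalM-swapTerms F u v)

evalM-symmetric : ∀ {N} (F : MPoly N) → SwapSymmetric F → ∀ u v → evalM F u v ≈ evalM F v u
evalM-symmetric F symmetric u v = ≈-sym (≈-trans (evalM-swapTerms F u v)
  (evalM-coefficients u v (swapTerms F) F λ a b → trans (mcoeff-swapTerms F a b) (sym (symmetric a b))))

-- t^(m+1) ≡ t  modulo t^m − 1, as t^(m+1) − t = (t^m − 1)·t.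
t^suc≡t : ∀ m → Modulo._∼_ ((tP ^P m) ⊕ (⊖ oneP)) (tP ^P suc m) tP
t^suc≡t m = Modulo.multiple tP (factor tP (tP ^P m))
  where
  factor : ∀ T X → ((T ⊛ X) ⊕ (⊖ T)) ≈ ((X ⊕ (⊖ oneP)) ⊛ T)
  factor = solve-∀ PolyRing-solver

-- Substituting t^p into itself gives t^(p²) ≡ t modulo t^(p²−1) − 1
-- (for p = k + 1, p·p − 1 reduces to k + k·p).
t^p∘t^p≡t : ∀ k → let p = suc k in Modulo._∼_ (modulus p) (compose (tP ^P p) (tP ^P p)) tP
t^p∘t^p≡t k = begin
  compose (tP ^P p) (tP ^P p) ≈⟨ compose-^P tP p (tP ^P p) ⟩
  compose tP (tP ^P p) ^P p   ≈⟨ ^P-cong p (compose-tˡ (tP ^P p)) ⟩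
  (tP ^P p) ^P p              ≈⟨ ^P-assocʳ tP p p ⟩
  tP ^P (p *ℕ p)              ≲⟨ t^suc≡t (k +ℕ k *ℕ p) ⟩
  tP                          ∎
  where
  p : ℕ
  p = suc k
  open Modulo (modulus p)
  open PreorderReasoning ∼-isPreorder

-- With T = t^p and H = G(t) = 𝔉(g(t), g(T)):
--   H(T) = 𝔉(g(T), g(T∘T)) ≡ 𝔉(g(T), g(t)) = 𝔉(g(t), g(T)) = H,
-- using that substitution commutes with evaluation, T∘T ≡ t, and symmetry.
mainTheorem4 : (N : ℕ) → N ≥ 1 → (F : MPoly N) → SwapSymmetric F →
    (g : Fin N → Poly) → (p : ℕ) → p ≥ 1 →
    G F g p ≡ atPow (G F g p) p [mod modulus p ]
mainTheorem4 _ _ _ _         _ zero    ()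
mainTheorem4 N _ F symmetric g p@(suc k) _ = ∼⇒≡mod (∼-sym (begin
  compose (evalM F g g∘T) T             ≈⟨ compose-evalM F g g∘T T ⟩
  evalM F g∘T (λ r → compose (g∘T r) T) ≲⟨ evalM-compat F (λ _ → ∼-refl) g∘T∘T≡g ⟩
  evalM F g∘T g                         ≈⟨ evalM-symmetric F symmetric g∘T g ⟩
  evalM F g g∘T                         ∎))
  where
  open Modulo (modulus p)
  open Compatible _∼_ ∼-refl ∼-⊕ ∼-⊛ ∼-scale
  open PreorderReasoning ∼-isPreorder
  T : Poly
  T = tP ^P p
  g∘T : Fin N → Poly
  g∘T r = compose (g r) T
  g∘T∘T≡g : ∀ r → compose (g∘T r) T ∼ g r
  g∘T∘T≡g r = begin
    compose (g∘T r) T           ≈⟨ compose-assoc (g r) T T ⟩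
    compose (g r) (compose T T) ≲⟨ compose-compat (g r) (t^p∘t^p≡t k) ⟩
    compose (g r) tP            ≈⟨ compose-tʳ (g r) ⟩
    g r                         ∎
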